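{- Let $p$ be a prime, $n\geq 1$ an integer, and $F_2(n)=\prod_{k=1}^n (k!)^{k}$. Then $$\nu_p\left[F_2(n)\right]\geq \frac{n(n+1)(2n+4-3p)}{6(p-1)}-\sum_{k=1}^nk\,\lfloor\log_p k\rfloor .$$
   Context: For a prime $p$ and a positive integer $m$, $\nu_p(m)=\max\{k\in\mathbb{N}: p^k\mid m\}$ denotes the $p$-adic valuation of $m$. $\lfloor x\rfloor$ is the floor function and $\log_p$ the base-$p$ logarithm. -}

module Defs where

open import Data.Nat using (ℕ; zero; suc; _+_; _*_; _∸_; _^_; _≤_; _≤?_; NonZero; _!)
open import Data.Nat.Properties using (≤-refl)
open import Data.Nat.Divisibility using (_∣_; _∣?_)

open import Data.Nat.Primality using (Prime; prime⇒nonZero)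
open import Data.Bool using (if_then_else_)
open import Relation.Nullary using (Dec; yes; no)
open import Relation.Nullary.Decidable using (does)
open import Relation.Unary using (Pred; Decidable)
open import Level using (0ℓ)

-- largest e ∈ {0,…,N} with P e (0 if none)
maxUpTo : {P : Pred ℕ 0ℓ} → Decidable P → ℕ → ℕ
maxUpTo P? zero = zero
maxUpTo P? (suc e) = if does (P? (suc e)) then suc e else maxUpTo P? e

-- p-adic valuation: ν_p(m) = max{k : p^k ∣ m}; for m ≥ 1 and p ≥ 2 any such k is < m,
-- so the search range {0,…,m} is exhaustive.
ν : ℕ → ℕ → ℕ
ν p m = maxUpTo (λ k → (p ^ k) ∣? m) m

-- ⌊log_p k⌋ = max{e : p^e ≤ k}  (for k ≥ 1, p ≥ 2; such e satisfy e < k)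
⌊log_⌋ : ℕ → ℕ → ℕ
⌊log_⌋ p k = maxUpTo (λ e → (p ^ e) ≤? k) k

sum1to : ℕ → (ℕ → ℕ) → ℕ
sum1to zero f = zero
sum1to (suc n) f = sum1to n f + f (suc n)

prod1to : ℕ → (ℕ → ℕ) → ℕ
prod1to zero f = 1
prod1to (suc n) f = prod1to n f * f (suc n)

F₂ : ℕ → ℕ
F₂ n = prod1to n (λ k → (k !) ^ k)

6[p-1]-nonZero : (p : ℕ) → Prime p → NonZero (6 * (p ∸ 1))
6[p-1]-nonZero (suc (suc q)) _ = _

-- Writing k = r + q p with r < p gives p^q q! ∣ (q p)! ∣ k!, hence ν_p(k!) ≥ ν_p(q!) + q; induction on
-- the number e of base-p digits of k then gives k ≤ (p - 1)(ν_p(k!) + e), i.e. Legendre's bound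
-- ν_p(k!) ≥ k/(p - 1) - ⌊log_p k⌋ - 1.  As p^{ν_p(k!)} ∣ k!, we get p^{Σ k ν_p(k!)} ∣ F₂(n), so
-- ν_p(F₂(n)) ≥ Σ k²/(p - 1) - Σ k ⌊log_p k⌋ - Σ k, and the closed forms of Σ k² and Σ k give the
-- stated bound.
{-# OPTIONS --safe #-}
module Submission where

open import Defs
open import Data.Nat using (ℕ; _*_; _+_; _≥_; _∸_)
open import Data.Nat.Primality using (Prime)
open import Data.Integer as ℤ using (ℤ; +_)
open import Data.Rational as ℚ using (ℚ; _/_)

open import Algebra.Properties.CommutativeSemigroup using (interchange)
open import Data.Empty using (⊥-elim)
open import Data.Nat using (zero; suc; _≤_; _<_; _^_; _!; _≤?_; z≤n; s≤s; NonZero; >-nonZero⁻¹)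
open import Data.Nat.Divisibility
  using (_∣_; _∣?_; 1∣_; ∣-refl; ∣⇒≤; *-pres-∣; *-monoʳ-∣; *-monoˡ-∣; m≤n⇒m!∣n!; module ∣-Reasoning)
open import Data.Nat.DivMod using (_%_; m≡m%n+[m/n]*n; m%n<n; m<n*o⇒m/o<n)
import Data.Nat.DivMod as ℕ using (_/_)
open import Data.Nat.Primality using (¬prime[0]; ¬prime[1])
open import Data.Nat.Properties
import Data.Nat.Tactic.RingSolver as ℕ-Solver
import Data.Integer.Properties as ℤP
import Data.Integer.Tactic.RingSolver as ℤ-Solver
import Data.Rational.Properties as ℚP
open import Data.Rational.Unnormalised as ℚᵘ using (mkℚᵘ; *≤*)
import Data.Rational.Unnormalised.Properties as ℚᵘP
open import Level using (0ℓ)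
open import Relation.Binary.PropositionalEquality
open import Relation.Nullary using (yes; no)
open import Relation.Unary using (Pred; Decidable)

module _ {P : Pred ℕ 0ℓ} (P? : Decidable P) where

  maxUpTo-maximal : ∀ {e} N → e ≤ N → P e → e ≤ maxUpTo P? N
  maxUpTo-maximal zero e≤0 _ = e≤0
  maxUpTo-maximal (suc N) e≤1+N Pe with P? (suc N)
  ... | yes _      = e≤1+N
  ... | no ¬P[1+N] = maxUpTo-maximal N (≤-pred (≤∧≢⇒< e≤1+N λ { refl → ¬P[1+N] Pe })) Pe

  maxUpTo-holds : P 0 → ∀ N → P (maxUpTo P? N)
  maxUpTo-holds P0 zero = P0
  maxUpTo-holds P0 (suc N) with P? (suc N)
  ... | yes P[1+N] = P[1+N]
  ... | no _       = maxUpTo-holds P0 N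

n<m^n : ∀ {m} → 1 < m → ∀ n → n < m ^ n
n<m^n 1<m zero = s≤s z≤n
n<m^n {m} 1<m (suc n) = ≤-<-trans (n<m^n 1<m n) (^-monoʳ-< m 1<m (n<1+n n))

p^ν∣ : ∀ p m → p ^ ν p m ∣ m
p^ν∣ p m = maxUpTo-holds (λ k → p ^ k ∣? m) (1∣ m) m

ν-maximal : ∀ {p m a} .{{_ : NonZero m}} → 1 < p → p ^ a ∣ m → a ≤ ν p m
ν-maximal {p} {m} {a} 1<p pᵃ∣m =
  maxUpTo-maximal (λ k → p ^ k ∣? m) m (<⇒≤ (<-≤-trans (n<m^n 1<p a) (∣⇒≤ pᵃ∣m))) pᵃ∣m

<^suc⌊log⌋ : ∀ {p} → 1 < p → ∀ k → k < p ^ suc (⌊log p ⌋ k)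
<^suc⌊log⌋ {p} 1<p k with p ^ suc (⌊log p ⌋ k) ≤? k
... | no  pᴸ⁺¹≰k = ≰⇒> pᴸ⁺¹≰k
... | yes pᴸ⁺¹≤k = ⊥-elim (n≮n _ (maxUpTo-maximal (λ e → p ^ e ≤? k) k 1+L≤k pᴸ⁺¹≤k))
  where 1+L≤k = <⇒≤ (<-≤-trans (n<m^n 1<p _) pᴸ⁺¹≤k)

^-monoˡ-∣ : ∀ {a b} k → a ∣ b → a ^ k ∣ b ^ k
^-monoˡ-∣ zero    _   = ∣-refl
^-monoˡ-∣ (suc k) a∣b = *-pres-∣ a∣b (^-monoˡ-∣ k a∣b)

p^q*q!∣[q*p]! : ∀ m q → suc m ^ q * q ! ∣ (q * suc m) !
p^q*q!∣[q*p]! m zero    = ∣-refl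
p^q*q!∣[q*p]! m (suc q) = begin
  p ^ suc q * suc q !          ≡⟨ interchange *-commutativeSemigroup p (p ^ q) (suc q) (q !) ⟩
  p * suc q * (p ^ q * q !)    ≡⟨ cong (_* (p ^ q * q !)) (*-comm p (suc q)) ⟩
  suc q * p * (p ^ q * q !)    ∣⟨ *-monoʳ-∣ (suc q * p) (p^q*q!∣[q*p]! m q) ⟩
  suc q * p * (q * p) !        ∣⟨ *-monoʳ-∣ (suc q * p) (m≤n⇒m!∣n! (m≤n+m (q * p) m)) ⟩
  (suc q * p) !                ∎
  where
  open ∣-Reasoning
  p = suc m

F₂≢0 : ∀ n → NonZero (F₂ n)
F₂≢0 zero    = _
F₂≢0 (suc n) = m*n≢0 (F₂ n) ((suc n !) ^ suc n) {{F₂≢0 n}} {{m^n≢0 (suc n !) (suc n) {{suc n !≢0}}}}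

p^Σk*ν[k!]∣F₂ : ∀ p n → p ^ sum1to n (λ k → k * ν p (k !)) ∣ F₂ n
p^Σk*ν[k!]∣F₂ p zero    = ∣-refl
p^Σk*ν[k!]∣F₂ p (suc n) = begin
  p ^ (S + suc n * a)           ≡⟨ ^-distribˡ-+-* p S (suc n * a) ⟩
  p ^ S * p ^ (suc n * a)       ≡⟨ cong (λ e → p ^ S * p ^ e) (*-comm (suc n) a) ⟩
  p ^ S * p ^ (a * suc n)       ≡⟨ cong (p ^ S *_) (^-*-assoc p a (suc n)) ⟨
  p ^ S * (p ^ a) ^ suc n       ∣⟨ *-pres-∣ (p^Σk*ν[k!]∣F₂ p n) (^-monoˡ-∣ (suc n) (p^ν∣ p (suc n !))) ⟩
  F₂ n * (suc n !) ^ suc n      ∎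
  where
  open ∣-Reasoning
  S = sum1to n (λ k → k * ν p (k !))
  a = ν p (suc n !)

Σk*ν[k!]≤ν[F₂] : ∀ {p} → 1 < p → ∀ n → sum1to n (λ k → k * ν p (k !)) ≤ ν p (F₂ n)
Σk*ν[k!]≤ν[F₂] {p} 1<p n = ν-maximal {{F₂≢0 n}} 1<p (p^Σk*ν[k!]∣F₂ p n)

sum1to-mono-≤ : ∀ n {f g : ℕ → ℕ} → (∀ k → f k ≤ g k) → sum1to n f ≤ sum1to n g
sum1to-mono-≤ zero    _   = z≤n
sum1to-mono-≤ (suc n) f≤g = +-mono-≤ (sum1to-mono-≤ n f≤g) (f≤g (suc n))

sum1to-distrib-+ : ∀ n (f g : ℕ → ℕ) → sum1to n (λ k → f k + g k) ≡ sum1to n f + sum1to n g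
sum1to-distrib-+ zero    f g = refl
sum1to-distrib-+ (suc n) f g = begin
  sum1to n (λ k → f k + g k) + (f (suc n) + g (suc n))
    ≡⟨ cong (_+ (f (suc n) + g (suc n))) (sum1to-distrib-+ n f g) ⟩
  sum1to n f + sum1to n g + (f (suc n) + g (suc n))
    ≡⟨ interchange +-commutativeSemigroup (sum1to n f) _ _ _ ⟩
  sum1to n f + f (suc n) + (sum1to n g + g (suc n))
    ∎
  where open ≡-Reasoning

sum1to-*ˡ : ∀ n c (f : ℕ → ℕ) → sum1to n (λ k → c * f k) ≡ c * sum1to n f
sum1to-*ˡ zero    c f = sym (*-zeroʳ c)
sum1to-*ˡ (suc n) c f = begin
  sum1to n (λ k → c * f k) + c * f (suc n) ≡⟨ cong (_+ c * f (suc n)) (sum1to-*ˡ n c f) ⟩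
  c * sum1to n f + c * f (suc n)           ≡⟨ *-distribˡ-+ c (sum1to n f) (f (suc n)) ⟨
  c * (sum1to n f + f (suc n))             ∎
  where open ≡-Reasoning

2*Σk≡n[n+1] : ∀ n → 2 * sum1to n (λ k → k) ≡ n * (n + 1)
2*Σk≡n[n+1] zero    = refl
2*Σk≡n[n+1] (suc n) = begin
  2 * (sum1to n (λ k → k) + suc n)    ≡⟨ *-distribˡ-+ 2 (sum1to n (λ k → k)) (suc n) ⟩
  2 * sum1to n (λ k → k) + 2 * suc n  ≡⟨ cong (_+ 2 * suc n) (2*Σk≡n[n+1] n) ⟩
  n * (n + 1) + 2 * suc n             ≡⟨ step n ⟩
  suc n * (suc n + 1)                 ∎
  where
  open ≡-Reasoning
  step : ∀ n → n * (n + 1) + 2 * suc n ≡ suc n * (suc n + 1)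
  step = ℕ-Solver.solve-∀

6*Σk²≡n[n+1][2n+1] : ∀ n → 6 * sum1to n (λ k → k * k) ≡ n * (n + 1) * (2 * n + 1)
6*Σk²≡n[n+1][2n+1] zero    = refl
6*Σk²≡n[n+1][2n+1] (suc n) = begin
  6 * (sum1to n (λ k → k * k) + suc n * suc n)     ≡⟨ *-distribˡ-+ 6 (sum1to n (λ k → k * k)) (suc n * suc n) ⟩
  6 * sum1to n (λ k → k * k) + 6 * (suc n * suc n) ≡⟨ cong (_+ 6 * (suc n * suc n)) (6*Σk²≡n[n+1][2n+1] n) ⟩
  n * (n + 1) * (2 * n + 1) + 6 * (suc n * suc n)  ≡⟨ step n ⟩
  suc n * (suc n + 1) * (2 * suc n + 1)            ∎
  where
  open ≡-Reasoning
  step : ∀ n → n * (n + 1) * (2 * n + 1) + 6 * (suc n * suc n) ≡ suc n * (suc n + 1) * (2 * suc n + 1)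
  step = ℕ-Solver.solve-∀

module Legendre (m : ℕ) .{{_ : NonZero m}} where

  p : ℕ
  p = suc m

  1<p : 1 < p
  1<p = s≤s (>-nonZero⁻¹ m)

  ν[q!]+q≤ν[k!] : ∀ {q k} → q * p ≤ k → ν p (q !) + q ≤ ν p (k !)
  ν[q!]+q≤ν[k!] {q} {k} q*p≤k = ν-maximal {{k !≢0}} 1<p (begin
    p ^ (ν p (q !) + q)     ≡⟨ ^-distribˡ-+-* p (ν p (q !)) q ⟩
    p ^ ν p (q !) * p ^ q   ∣⟨ *-monoˡ-∣ (p ^ q) (p^ν∣ p (q !)) ⟩
    q ! * p ^ q             ≡⟨ *-comm (q !) (p ^ q) ⟩
    p ^ q * q !             ∣⟨ p^q*q!∣[q*p]! m q ⟩
    (q * p) !               ∣⟨ m≤n⇒m!∣n! q*p≤k ⟩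
    k !                     ∎)
    where open ∣-Reasoning

  k<pᵉ⇒k≤m*ν[k!]+m*e : ∀ e k → k < p ^ e → k ≤ m * ν p (k !) + m * e
  k<pᵉ⇒k≤m*ν[k!]+m*e zero    zero    _          = z≤n
  k<pᵉ⇒k≤m*ν[k!]+m*e zero    (suc k) (s≤s ())
  k<pᵉ⇒k≤m*ν[k!]+m*e (suc e) k       k<p^[1+e] = begin
    k                               ≡⟨ m≡m%n+[m/n]*n k p ⟩
    k % p + q * p                   ≤⟨ +-monoˡ-≤ (q * p) (<⇒≤pred (m%n<n k p)) ⟩
    m + q * p                       ≡⟨ cong (_+_ m) (*-suc q m) ⟩
    m + (q + q * m)                 ≤⟨ +-monoʳ-≤ m (+-monoˡ-≤ (q * m) (k<pᵉ⇒k≤m*ν[k!]+m*e e q q<pᵉ)) ⟩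
    m + (m * ν p (q !) + m * e + q * m) ≡⟨ regroup m (ν p (q !)) q e ⟩
    m * (ν p (q !) + q) + m * suc e ≤⟨ +-monoˡ-≤ (m * suc e) (*-monoʳ-≤ m (ν[q!]+q≤ν[k!] {q} q*p≤k)) ⟩
    m * ν p (k !) + m * suc e       ∎
    where
    open ≤-Reasoning
    regroup : ∀ m a q e → m + (m * a + m * e + q * m) ≡ m * (a + q) + m * suc e
    regroup = ℕ-Solver.solve-∀
    q = k ℕ./ p
    q*p≤k : q * p ≤ k
    q*p≤k = subst (q * p ≤_) (sym (m≡m%n+[m/n]*n k p)) (m≤n+m (q * p) (k % p))
    q<pᵉ : q < p ^ e
    q<pᵉ = m<n*o⇒m/o<n (subst (k <_) (*-comm p (p ^ e)) k<p^[1+e])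

  k≤m*ν[k!]+m*[1+⌊log⌋k] : ∀ k → k ≤ m * ν p (k !) + m * suc (⌊log p ⌋ k)
  k≤m*ν[k!]+m*[1+⌊log⌋k] k = k<pᵉ⇒k≤m*ν[k!]+m*e (suc (⌊log p ⌋ k)) k (<^suc⌊log⌋ 1<p k)

  Σk²≤m*[ν[F₂]+Σk⌊log⌋k+Σk] : ∀ n →
    sum1to n (λ k → k * k) ≤ m * (ν p (F₂ n) + sum1to n (λ k → k * ⌊log p ⌋ k) + sum1to n (λ k → k))
  Σk²≤m*[ν[F₂]+Σk⌊log⌋k+Σk] n = begin
    sum1to n (λ k → k * k)                                     ≤⟨ sum1to-mono-≤ n k²≤ ⟩
    sum1to n (λ k → m * (k * ν p (k !) + k * ⌊log p ⌋ k + k))  ≡⟨ sum1to-*ˡ n m _ ⟩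
    m * sum1to n (λ k → k * ν p (k !) + k * ⌊log p ⌋ k + k)    ≡⟨ cong (m *_) sum-split ⟩
    m * (Σkν + Σk⌊log⌋k + Σk)
      ≤⟨ *-monoʳ-≤ m (+-monoˡ-≤ Σk (+-monoˡ-≤ Σk⌊log⌋k (Σk*ν[k!]≤ν[F₂] 1<p n))) ⟩
    m * (ν p (F₂ n) + Σk⌊log⌋k + Σk)                           ∎
    where
    open ≤-Reasoning
    Σkν = sum1to n (λ k → k * ν p (k !))
    Σk⌊log⌋k = sum1to n (λ k → k * ⌊log p ⌋ k)
    Σk = sum1to n (λ k → k)
    regroup : ∀ k m a l → k * (m * a + m * suc l) ≡ m * (k * a + k * l + k)
    regroup = ℕ-Solver.solve-∀
    k²≤ : ∀ k → k * k ≤ m * (k * ν p (k !) + k * ⌊log p ⌋ k + k)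
    k²≤ k = ≤-trans (*-monoʳ-≤ k (k≤m*ν[k!]+m*[1+⌊log⌋k] k))
                    (≤-reflexive (regroup k m (ν p (k !)) (⌊log p ⌋ k)))
    sum-split : sum1to n (λ k → k * ν p (k !) + k * ⌊log p ⌋ k + k) ≡ Σkν + Σk⌊log⌋k + Σk
    sum-split = trans (sum1to-distrib-+ n _ (λ k → k)) (cong (_+ Σk) (sum1to-distrib-+ n _ _))

closed-form-bound : ∀ n m V L → sum1to n (λ k → k * k) ≤ m * (V + L + sum1to n (λ k → k)) →
  n * (n + 1) * (2 * n + 4) ≤ (L + V) * (6 * m) + n * (n + 1) * (3 * suc m)
closed-form-bound n m V L Σk²≤ = begin
  n * (n + 1) * (2 * n + 4)                     ≡⟨ split n ⟩
  n * (n + 1) * (2 * n + 1) + 3 * (n * (n + 1))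
    ≡⟨ cong₂ (λ a b → a + 3 * b) (6*Σk²≡n[n+1][2n+1] n) (2*Σk≡n[n+1] n) ⟨
  6 * Σk² + 3 * (2 * Σk)                        ≤⟨ +-monoˡ-≤ (3 * (2 * Σk)) (*-monoʳ-≤ 6 Σk²≤) ⟩
  6 * (m * (V + L + Σk)) + 3 * (2 * Σk)         ≡⟨ regroup m V L Σk ⟩
  (L + V) * (6 * m) + 2 * Σk * (3 * suc m)
    ≡⟨ cong (λ a → (L + V) * (6 * m) + a * (3 * suc m)) (2*Σk≡n[n+1] n) ⟩
  (L + V) * (6 * m) + n * (n + 1) * (3 * suc m) ∎
  where
  open ≤-Reasoning
  Σk² = sum1to n (λ k → k * k)
  Σk = sum1to n (λ k → k)
  split : ∀ n → n * (n + 1) * (2 * n + 4) ≡ n * (n + 1) * (2 * n + 1) + 3 * (n * (n + 1))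
  split = ℕ-Solver.solve-∀
  regroup : ∀ m V L S → 6 * (m * (V + L + S)) + 3 * (2 * S) ≡ (L + V) * (6 * m) + 2 * S * (3 * suc m)
  regroup = ℕ-Solver.solve-∀

[+M]*[+a-+b]≤+r : ∀ M a b {r} → M * a ≤ r + M * b → + M ℤ.* (+ a ℤ.- + b) ℤ.≤ + r
[+M]*[+a-+b]≤+r M a b {r} Ma≤r+Mb = begin
  + M ℤ.* (+ a ℤ.- + b)                   ≡⟨ ℤP.*-distribˡ-+ (+ M) (+ a) (ℤ.- + b) ⟩
  + M ℤ.* + a ℤ.+ + M ℤ.* ℤ.- + b         ≡⟨ cong (ℤ._+_ (+ M ℤ.* + a)) (ℤP.neg-distribʳ-* (+ M) (+ b)) ⟨
  + M ℤ.* + a ℤ.- + M ℤ.* + b             ≡⟨ cong₂ ℤ._-_ (ℤP.pos-* M a) (ℤP.pos-* M b) ⟨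
  + (M * a) ℤ.- + (M * b)                 ≡⟨ ℤP.[+m]-[+n]≡m⊖n (M * a) (M * b) ⟩
  (M * a) ℤ.⊖ (M * b)                     ≤⟨ ℤP.⊖-monoˡ-≤ (M * b) Ma≤r+Mb ⟩
  (r + M * b) ℤ.⊖ (M * b)                 ≡⟨ ℤP.≤-⊖ (m≤n+m (M * b) r) ⟩
  + (r + M * b ∸ M * b)                   ≡⟨ cong +_ (m+n∸n≡m r (M * b)) ⟩
  + r                                     ∎
  where open ℤP.≤-Reasoning

-- ℚ's normalised x / suc d is compared through toℚᵘ, under which it becomes literally mkℚᵘ x d.
x/d-y≤z : ∀ {x d y z} → x ℤ.≤ + ((y + z) * suc d) → x / suc d ℚ.- + y / 1 ℚ.≤ + z / 1
x/d-y≤z {x} {d} {y} {z} x≤[y+z]D = ℚP.toℚᵘ-cancel-≤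
  (ℚᵘP.≤-respʳ-≃ (ℚᵘP.≃-sym toℚᵘ-rhs) (ℚᵘP.≤-respˡ-≃ (ℚᵘP.≃-sym toℚᵘ-lhs) (*≤* (begin
  (x ℤ.* + 1 ℤ.+ ℤ.- + y ℤ.* D) ℤ.* + 1   ≡⟨ drop-units x (+ y) D ⟩
  x ℤ.- + y ℤ.* D                          ≤⟨ ℤP.+-monoˡ-≤ (ℤ.- (+ y ℤ.* D)) x≤[y+z]D ⟩
  + ((y + z) * suc d) ℤ.- + y ℤ.* D        ≡⟨ cong (ℤ._- + y ℤ.* D) [y+z]D≡ ⟩
  (+ y ℤ.+ + z) ℤ.* D ℤ.- + y ℤ.* D        ≡⟨ cancel (+ y) (+ z) D ⟩
  + z ℤ.* D                                ≡⟨ cong (λ n → + z ℤ.* + suc n) (*-identityʳ d) ⟨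
  + z ℤ.* + suc (d * 1)                    ∎))))
  where
  open ℤP.≤-Reasoning
  D = + suc d
  [y+z]D≡ : + ((y + z) * suc d) ≡ (+ y ℤ.+ + z) ℤ.* D
  [y+z]D≡ = trans (ℤP.pos-* (y + z) (suc d)) (cong (ℤ._* D) (ℤP.pos-+ y z))
  drop-units : ∀ x y D → (x ℤ.* + 1 ℤ.+ ℤ.- y ℤ.* D) ℤ.* + 1 ≡ x ℤ.- y ℤ.* D
  drop-units = ℤ-Solver.solve-∀
  cancel : ∀ y z D → (y ℤ.+ z) ℤ.* D ℤ.- y ℤ.* D ≡ z ℤ.* D
  cancel = ℤ-Solver.solve-∀
  toℚᵘ-lhs : ℚ.toℚᵘ (x / suc d ℚ.- + y / 1) ℚᵘ.≃ mkℚᵘ x d ℚᵘ.- mkℚᵘ (+ y) 0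
  toℚᵘ-lhs = ℚᵘP.≃-trans (ℚP.toℚᵘ-homo-+ (x / suc d) (ℚ.- (+ y / 1)))
    (ℚᵘP.+-cong (ℚP.toℚᵘ-fromℚᵘ (mkℚᵘ x d))
      (ℚᵘP.≃-trans (ℚP.toℚᵘ-homo‿- (+ y / 1)) (ℚᵘP.-‿cong (ℚP.toℚᵘ-fromℚᵘ (mkℚᵘ (+ y) 0)))))
  toℚᵘ-rhs : ℚ.toℚᵘ (+ z / 1) ℚᵘ.≃ mkℚᵘ (+ z) 0
  toℚᵘ-rhs = ℚP.toℚᵘ-fromℚᵘ (mkℚᵘ (+ z) 0)

mainTheorem7 : (p : ℕ) (pp : Prime p) (n : ℕ) → n ≥ 1 →
    ℚ._≤_
      (ℚ._-_
        (_/_ (ℤ._*_ (+ (n * (n + 1))) (ℤ._-_ (+ (2 * n + 4)) (+ (3 * p))))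
             (6 * (p ∸ 1)) {{6[p-1]-nonZero p pp}})
        (+ (sum1to n (λ k → k * ⌊log p ⌋ k)) / 1))
      (+ (ν p (F₂ n)) / 1)
mainTheorem7 zero          p-prime _ _ = ⊥-elim (¬prime[0] p-prime)
mainTheorem7 (suc zero)    p-prime _ _ = ⊥-elim (¬prime[1] p-prime)
mainTheorem7 (suc (suc m)) _       n _ =
  x/d-y≤z {y = Σk⌊log⌋k} {z = ν p (F₂ n)} ([+M]*[+a-+b]≤+r (n * (n + 1)) (2 * n + 4) (3 * p) bound)
  where
  p = suc (suc m)
  Σk⌊log⌋k = sum1to n (λ k → k * ⌊log p ⌋ k)
  bound : n * (n + 1) * (2 * n + 4) ≤ (Σk⌊log⌋k + ν p (F₂ n)) * (6 * suc m) + n * (n + 1) * (3 * p)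
  bound = closed-form-bound n (suc m) (ν p (F₂ n)) Σk⌊log⌋k
    (Legendre.Σk²≤m*[ν[F₂]+Σk⌊log⌋k+Σk] (suc m) n)
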